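{- Let $p\ge 3$ be a prime. For $m\in\{1,-1\}$ define integers $d_m(n)$ by $$\frac{1}{(1-x)^{m}}\prod_{i=0}^{\infty}\frac{1}{(1-x^{p^{i}})^{(p-1)m}}=\sum_{n=0}^{\infty}d_{m}(n)x^{n}.$$ For $n\ge1$ let $y_p(n)$ be the residue of $d_1(n)/p$ modulo $p$ and $z_p(n)$ the residue of $d_{ -1}(n)/p$ modulo $p$ (these quotients are integers). Then for every integer $n\ge 1$, $$y_p(n)+z_p(n)\equiv 0\pmod p.$$
   Context: In the paper $y_p(n)$ is defined as the residue of $d_m(n)/(pm)$ for any $m>0$ and $z_p(n)$ as the residue of $-d_m(n)/(pm)$ for any $m<0$; taking $m=1$ and $m=-1$ gives the definitions above. -}

module Defs where

open import Data.Nat as ℕ using (ℕ; zero; suc; _^_)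
open import Data.Nat.Divisibility using (_∣?_)
open import Data.Integer as ℤ using (ℤ; +_; _+_; _*_; -_)
open import Data.List using (List; []; _∷_; map; upTo; foldr)
open import Relation.Nullary.Decidable using (does)
open import Data.Bool using (if_then_else_)

PowerSeries : Set
PowerSeries = ℕ → ℤ

one : PowerSeries
one zero    = + 1
one (suc _) = + 0

sumℤ : List ℤ → ℤ
sumℤ = foldr _+_ (+ 0)

_⊛_ : PowerSeries → PowerSeries → PowerSeries
(a ⊛ b) n = sumℤ (map (λ k → a k * b (n ℕ.∸ k)) (upTo (suc n)))

_⊛^_ : PowerSeries → ℕ → PowerSeries
a ⊛^ zero  = one
a ⊛^ suc k = a ⊛ (a ⊛^ k)

-- 1/(1 - x^q) = Σ_j x^{qj}   (used with q ≥ 1)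
geom : ℕ → PowerSeries
geom q n = if does (q ∣? n) then + 1 else + 0

oneMinus : ℕ → PowerSeries
oneMinus q n = (if does (n ℕ.≟ 0) then + 1 else + 0)
             + (if does (n ℕ.≟ q) then - (+ 1) else + 0)

prodUpTo : ℕ → (ℕ → PowerSeries) → PowerSeries
prodUpTo N f = foldr (λ i acc → f i ⊛ acc) one (upTo (suc N))

-- Factors with p^i > n do not affect the coefficient of x^n, and p^i > n
-- for i > n, so the product over 0 ≤ i ≤ n gives exactly this coefficient.
d₁ : ℕ → ℕ → ℤ
d₁ p n = (geom 1 ⊛ prodUpTo n (λ i → geom (p ^ i) ⊛^ (p ℕ.∸ 1))) n

d₋₁ : ℕ → ℕ → ℤ
d₋₁ p n = (oneMinus 1 ⊛ prodUpTo n (λ i → oneMinus (p ^ i) ⊛^ (p ℕ.∸ 1))) n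

-- Truncate both generating functions at the index n, calling them A = D₁ p n and B = D₋₁ p n;
-- the factors of A are the inverses of those of B, so A ⊛ B = 1. The Frobenius congruence
-- (1 - x^Q)^p ≡ 1 - x^(pQ) (mod p) makes the product defining B telescope:
-- B ≡ 1 - x^(p^(n+1)) (mod p), so p divides b_k for 1 ≤ k ≤ n. Comparing coefficients in
-- A ⊛ B = 1 gives a_k + b_k = -Σ_{0<i<k} a_i b_(k-i); by strong induction p divides each a_k,
-- and then p² divides a_n + b_n, which is the congruence of the residues of a_n/p and b_n/p.

module Submission where

open import Defs
open import Data.Nat using (ℕ; _≤_; _%_; NonZero)
open import Data.Nat.Primality using (Prime)
open import Data.Integer using (+_)
open import Data.Integer.Divisibility using (_∣_)
open import Data.Integer.DivMod using (_/ℕ_; _%ℕ_)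
open import Data.Product using (_×_)
open import Relation.Binary.PropositionalEquality using (_≡_)

open import Level using (0ℓ)
open import Function using (_∘_; id)
open import Data.Bool using (if_then_else_)
open import Data.Product using (_,_; proj₁; proj₂)
open import Data.Sum using (inj₁; inj₂)
open import Data.List using (map; applyUpTo; upTo; foldr)
open import Data.List.Properties using (map-applyUpTo; map-cong)
open import Data.Nat as ℕ using (zero; suc; _<_; z≤n; s≤s)
import Data.Nat.Properties as ℕ
import Data.Nat.Divisibility as ℕ
import Data.Nat.DivMod as ℕ
open import Data.Nat.Induction using (<-rec)
open import Data.Nat.Combinatorics using (_C_; nC1≡n; nCn≡1; k>n⇒nCk≡0; nCk+nC[k+1]≡[n+1]C[k+1])
open import Data.Nat.Primality using (euclidsLemma; composite; prime⇒nonTrivial)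
open import Data.Nat.Tactic.RingSolver using () renaming (solve-∀ to ℕ-solve-∀)
open import Data.Integer using (ℤ; 0ℤ; 1ℤ; -1ℤ; _+_; _*_; _-_; -_; _^_)
import Data.Integer.Properties as ℤ
open import Data.Integer.DivMod using (a≡a%ℕn+[a/ℕn]*n; n%ℕd<d)
open import Data.Integer.Divisibility.Signed
  using (divides; ∣ᵤ⇒∣; ∣⇒∣ᵤ; ∣-trans; ∣m∣n⇒∣m+n; ∣m∣n⇒∣m-n; ∣m+n∣n⇒∣m; ∣m⇒∣-m; ∣n⇒∣m*n; ∣m⇒∣m*n;
         *-monoˡ-∣; *-monoʳ-∣; *-cancelʳ-∣)
  renaming (_∣_ to _∣ₛ_; ∣-refl to ∣ₛ-refl)
open import Data.Integer.Tactic.RingSolver using (solve-∀)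
open import Relation.Nullary using (¬_; yes; no; contradiction)
open import Relation.Nullary.Decidable using (does; dec-true; dec-false)
open import Relation.Binary.Bundles using (Setoid)
open import Relation.Binary.Definitions using (tri<; tri≈; tri>)
open import Relation.Binary.PropositionalEquality
import Relation.Binary.Reasoning.Setoid as SetoidReasoning
open import Algebra.Bundles using (CommutativeMonoid)
open import Algebra.Structures using (IsCommutativeMonoid)
open import Algebra.Structures.Biased using (isCommutativeMonoidˡ)
open import Algebra.Properties.CommutativeSemigroup ℕ.+-commutativeSemigroup using (x∙yz≈y∙xz)

⊛-at-zero : ∀ a b → (a ⊛ b) 0 ≡ a 0 * b 0
⊛-at-zero a b = ℤ.+-identityʳ (a 0 * b 0)

⊛-at-suc : ∀ a b n → (a ⊛ b) (suc n) ≡ a 0 * b (suc n) + ((a ∘ suc) ⊛ b) n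
⊛-at-suc a b n = cong (λ xs → a 0 * b (suc n) + sumℤ xs) (begin
  map g (applyUpTo suc (suc n))       ≡⟨ map-applyUpTo suc g (suc n) ⟩
  applyUpTo (g ∘ suc) (suc n)         ≡⟨ map-applyUpTo id (g ∘ suc) (suc n) ⟨
  map (g ∘ suc) (applyUpTo id (suc n)) ∎)
  where
  open ≡-Reasoning
  g = λ k → a k * b (suc n ℕ.∸ k)

⊛-at-sucʳ : ∀ a b n → (a ⊛ b) (suc n) ≡ (a ⊛ (b ∘ suc)) n + a (suc n) * b 0
⊛-at-sucʳ a b zero = begin
  (a ⊛ b) 1                     ≡⟨ ⊛-at-suc a b 0 ⟩
  a 0 * b 1 + ((a ∘ suc) ⊛ b) 0 ≡⟨ cong₂ _+_ (sym (⊛-at-zero a (b ∘ suc))) (⊛-at-zero (a ∘ suc) b) ⟩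
  (a ⊛ (b ∘ suc)) 0 + a 1 * b 0 ∎
  where open ≡-Reasoning
⊛-at-sucʳ a b (suc n) = begin
  (a ⊛ b) (2 ℕ.+ n)                                          ≡⟨ ⊛-at-suc a b (suc n) ⟩
  a 0 * b (2 ℕ.+ n) + ((a ∘ suc) ⊛ b) (suc n)                ≡⟨ cong (_+_ (a 0 * b (2 ℕ.+ n))) (⊛-at-sucʳ (a ∘ suc) b n) ⟩
  a 0 * b (2 ℕ.+ n) + (((a ∘ suc) ⊛ (b ∘ suc)) n + a (2 ℕ.+ n) * b 0) ≡⟨ ℤ.+-assoc (a 0 * b (2 ℕ.+ n)) _ _ ⟨
  (a 0 * b (2 ℕ.+ n) + ((a ∘ suc) ⊛ (b ∘ suc)) n) + a (2 ℕ.+ n) * b 0 ≡⟨ cong (_+ a (2 ℕ.+ n) * b 0) (⊛-at-suc a (b ∘ suc) n) ⟨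
  (a ⊛ (b ∘ suc)) (suc n) + a (2 ℕ.+ n) * b 0                ∎
  where open ≡-Reasoning

⊛-cong : ∀ {a a′ b b′} → a ≗ a′ → b ≗ b′ → a ⊛ b ≗ a′ ⊛ b′
⊛-cong {a} {a′} {b} {b′} a≗a′ b≗b′ n =
  cong sumℤ (map-cong (λ k → cong₂ _*_ (a≗a′ k) (b≗b′ (n ℕ.∸ k))) (upTo (suc n)))

⊛-comm : ∀ a b → a ⊛ b ≗ b ⊛ a
⊛-comm a b zero = begin
  (a ⊛ b) 0 ≡⟨ ⊛-at-zero a b ⟩
  a 0 * b 0 ≡⟨ ℤ.*-comm (a 0) (b 0) ⟩
  b 0 * a 0 ≡⟨ ⊛-at-zero b a ⟨
  (b ⊛ a) 0 ∎
  where open ≡-Reasoning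
⊛-comm a b (suc n) = begin
  (a ⊛ b) (suc n)                       ≡⟨ ⊛-at-suc a b n ⟩
  a 0 * b (suc n) + ((a ∘ suc) ⊛ b) n   ≡⟨ cong (_+_ (a 0 * b (suc n))) (⊛-comm (a ∘ suc) b n) ⟩
  a 0 * b (suc n) + (b ⊛ (a ∘ suc)) n   ≡⟨ swap (a 0) (b (suc n)) _ ⟩
  (b ⊛ (a ∘ suc)) n + b (suc n) * a 0   ≡⟨ ⊛-at-sucʳ b a n ⟨
  (b ⊛ a) (suc n)                       ∎
  where
  open ≡-Reasoning
  swap : ∀ x y z → x * y + z ≡ z + y * x
  swap = solve-∀

⊛-linearˡ : ∀ x f g c n → ((λ k → x * f k + g k) ⊛ c) n ≡ x * (f ⊛ c) n + (g ⊛ c) n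
⊛-linearˡ x f g c zero = begin
  ((λ k → x * f k + g k) ⊛ c) 0  ≡⟨ ⊛-at-zero (λ k → x * f k + g k) c ⟩
  (x * f 0 + g 0) * c 0          ≡⟨ distrib x (f 0) (g 0) (c 0) ⟩
  x * (f 0 * c 0) + g 0 * c 0    ≡⟨ cong₂ (λ u v → x * u + v) (⊛-at-zero f c) (⊛-at-zero g c) ⟨
  x * (f ⊛ c) 0 + (g ⊛ c) 0      ∎
  where
  open ≡-Reasoning
  distrib : ∀ x y z w → (x * y + z) * w ≡ x * (y * w) + z * w
  distrib = solve-∀
⊛-linearˡ x f g c (suc n) = begin
  ((λ k → x * f k + g k) ⊛ c) (suc n)
    ≡⟨ ⊛-at-suc (λ k → x * f k + g k) c n ⟩
  (x * f 0 + g 0) * c (suc n) + ((λ k → x * f (suc k) + g (suc k)) ⊛ c) n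
    ≡⟨ cong (_+_ ((x * f 0 + g 0) * c (suc n))) (⊛-linearˡ x (f ∘ suc) (g ∘ suc) c n) ⟩
  (x * f 0 + g 0) * c (suc n) + (x * ((f ∘ suc) ⊛ c) n + ((g ∘ suc) ⊛ c) n)
    ≡⟨ regroup x (f 0) (g 0) (c (suc n)) _ _ ⟩
  x * (f 0 * c (suc n) + ((f ∘ suc) ⊛ c) n) + (g 0 * c (suc n) + ((g ∘ suc) ⊛ c) n)
    ≡⟨ cong₂ (λ u v → x * u + v) (⊛-at-suc f c n) (⊛-at-suc g c n) ⟨
  x * (f ⊛ c) (suc n) + (g ⊛ c) (suc n)
    ∎
  where
  open ≡-Reasoning
  regroup : ∀ x y z w F G → (x * y + z) * w + (x * F + G) ≡ x * (y * w + F) + (z * w + G)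
  regroup = solve-∀

⊛-assoc : ∀ a b c → (a ⊛ b) ⊛ c ≗ a ⊛ (b ⊛ c)
⊛-assoc a b c zero = begin
  ((a ⊛ b) ⊛ c) 0     ≡⟨ ⊛-at-zero (a ⊛ b) c ⟩
  (a ⊛ b) 0 * c 0     ≡⟨ cong (_* c 0) (⊛-at-zero a b) ⟩
  a 0 * b 0 * c 0     ≡⟨ ℤ.*-assoc (a 0) (b 0) (c 0) ⟩
  a 0 * (b 0 * c 0)   ≡⟨ cong (a 0 *_) (⊛-at-zero b c) ⟨
  a 0 * (b ⊛ c) 0     ≡⟨ ⊛-at-zero a (b ⊛ c) ⟨
  (a ⊛ (b ⊛ c)) 0     ∎
  where open ≡-Reasoning
⊛-assoc a b c (suc n) = begin
  ((a ⊛ b) ⊛ c) (suc n)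
    ≡⟨ ⊛-at-suc (a ⊛ b) c n ⟩
  (a ⊛ b) 0 * c (suc n) + (((a ⊛ b) ∘ suc) ⊛ c) n
    ≡⟨ cong₂ (λ u v → u * c (suc n) + v) (⊛-at-zero a b) (⊛-cong {b = c} (⊛-at-suc a b) (λ _ → refl) n) ⟩
  a 0 * b 0 * c (suc n) + ((λ k → a 0 * b (suc k) + ((a ∘ suc) ⊛ b) k) ⊛ c) n
    ≡⟨ cong (_+_ (a 0 * b 0 * c (suc n))) (⊛-linearˡ (a 0) (b ∘ suc) ((a ∘ suc) ⊛ b) c n) ⟩
  a 0 * b 0 * c (suc n) + (a 0 * ((b ∘ suc) ⊛ c) n + (((a ∘ suc) ⊛ b) ⊛ c) n)
    ≡⟨ cong (λ v → a 0 * b 0 * c (suc n) + (a 0 * ((b ∘ suc) ⊛ c) n + v)) (⊛-assoc (a ∘ suc) b c n) ⟩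
  a 0 * b 0 * c (suc n) + (a 0 * ((b ∘ suc) ⊛ c) n + ((a ∘ suc) ⊛ (b ⊛ c)) n)
    ≡⟨ regroup (a 0) (b 0) (c (suc n)) _ _ ⟩
  a 0 * (b 0 * c (suc n) + ((b ∘ suc) ⊛ c) n) + ((a ∘ suc) ⊛ (b ⊛ c)) n
    ≡⟨ cong (λ u → a 0 * u + ((a ∘ suc) ⊛ (b ⊛ c)) n) (⊛-at-suc b c n) ⟨
  a 0 * (b ⊛ c) (suc n) + ((a ∘ suc) ⊛ (b ⊛ c)) n
    ≡⟨ ⊛-at-suc a (b ⊛ c) n ⟨
  (a ⊛ (b ⊛ c)) (suc n)
    ∎
  where
  open ≡-Reasoning
  regroup : ∀ x y z F G → x * y * z + (x * F + G) ≡ x * (y * z + F) + G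
  regroup = solve-∀

⊛-zeroˡ : ∀ b → (λ _ → 0ℤ) ⊛ b ≗ (λ _ → 0ℤ)
⊛-zeroˡ b zero    = ⊛-at-zero (λ _ → 0ℤ) b
⊛-zeroˡ b (suc n) = trans (⊛-at-suc (λ _ → 0ℤ) b n) (trans (ℤ.+-identityˡ _) (⊛-zeroˡ b n))

⊛-identityˡ : ∀ b → one ⊛ b ≗ b
⊛-identityˡ b zero = trans (⊛-at-zero one b) (ℤ.*-identityˡ (b 0))
⊛-identityˡ b (suc n) = begin
  (one ⊛ b) (suc n)                     ≡⟨ ⊛-at-suc one b n ⟩
  1ℤ * b (suc n) + ((λ _ → 0ℤ) ⊛ b) n   ≡⟨ cong₂ _+_ (ℤ.*-identityˡ (b (suc n))) (⊛-zeroˡ b n) ⟩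
  b (suc n) + 0ℤ                        ≡⟨ ℤ.+-identityʳ (b (suc n)) ⟩
  b (suc n)                             ∎
  where open ≡-Reasoning

⊛-isCommutativeMonoid : IsCommutativeMonoid _≗_ _⊛_ one
⊛-isCommutativeMonoid = isCommutativeMonoidˡ record
  { isSemigroup = record
    { isMagma = record
      { isEquivalence = record { refl = λ _ → refl ; sym = λ e n → sym (e n) ; trans = λ e f n → trans (e n) (f n) }
      ; ∙-cong = ⊛-cong
      }
    ; assoc = ⊛-assoc
    }
  ; identityˡ = ⊛-identityˡ
  ; comm = ⊛-comm
  }

⊛-commutativeMonoid : CommutativeMonoid 0ℓ 0ℓ
⊛-commutativeMonoid = record { isCommutativeMonoid = ⊛-isCommutativeMonoid }

open CommutativeMonoid ⊛-commutativeMonoid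
  using () renaming (identityʳ to ⊛-identityʳ; setoid to ≗-setoid)
open import Algebra.Properties.CommutativeSemigroup
  (CommutativeMonoid.commutativeSemigroup ⊛-commutativeMonoid)
  using () renaming (interchange to ⊛-interchange)

∏ : ℕ → (ℕ → PowerSeries) → PowerSeries
∏ zero    F = one
∏ (suc m) F = F 0 ⊛ ∏ m (F ∘ suc)

foldr-applyUpTo≡∏ : ∀ F (g : ℕ → ℕ) m → foldr (λ i acc → F i ⊛ acc) one (applyUpTo g m) ≡ ∏ m (F ∘ g)
foldr-applyUpTo≡∏ F g zero    = refl
foldr-applyUpTo≡∏ F g (suc m) = cong (_⊛_ (F (g 0))) (foldr-applyUpTo≡∏ F (g ∘ suc) m)

prodUpTo≡∏ : ∀ N F → prodUpTo N F ≡ ∏ (suc N) F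
prodUpTo≡∏ N F = foldr-applyUpTo≡∏ F id (suc N)

⊛^-inverse : ∀ {a b} → a ⊛ b ≗ one → ∀ m → (a ⊛^ m) ⊛ (b ⊛^ m) ≗ one
⊛^-inverse {a} {b} a⊛b≗1 zero    = ⊛-identityˡ one
⊛^-inverse {a} {b} a⊛b≗1 (suc m) = begin
  (a ⊛ (a ⊛^ m)) ⊛ (b ⊛ (b ⊛^ m)) ≈⟨ ⊛-interchange a (a ⊛^ m) b (b ⊛^ m) ⟩
  (a ⊛ b) ⊛ ((a ⊛^ m) ⊛ (b ⊛^ m)) ≈⟨ ⊛-cong a⊛b≗1 (⊛^-inverse a⊛b≗1 m) ⟩
  one ⊛ one                       ≈⟨ ⊛-identityˡ one ⟩
  one                             ∎
  where open SetoidReasoning ≗-setoid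

∏-inverse : ∀ {F G} → (∀ i → F i ⊛ G i ≗ one) → ∀ m → ∏ m F ⊛ ∏ m G ≗ one
∏-inverse F⊛G≗1 zero = ⊛-identityˡ one
∏-inverse {F} {G} F⊛G≗1 (suc m) = begin
  (F 0 ⊛ ∏ m (F ∘ suc)) ⊛ (G 0 ⊛ ∏ m (G ∘ suc))  ≈⟨ ⊛-interchange (F 0) _ (G 0) _ ⟩
  (F 0 ⊛ G 0) ⊛ (∏ m (F ∘ suc) ⊛ ∏ m (G ∘ suc))  ≈⟨ ⊛-cong (F⊛G≗1 0) (∏-inverse (F⊛G≗1 ∘ suc) m) ⟩
  one ⊛ one                                       ≈⟨ ⊛-identityˡ one ⟩
  one                                             ∎
  where open SetoidReasoning ≗-setoid

⊛-at-zero-one : ∀ a b → a 0 ≡ 1ℤ → b 0 ≡ 1ℤ → (a ⊛ b) 0 ≡ 1ℤ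
⊛-at-zero-one a b a₀≡1 b₀≡1 = trans (⊛-at-zero a b) (cong₂ _*_ a₀≡1 b₀≡1)

⊛^-at-zero-one : ∀ a → a 0 ≡ 1ℤ → ∀ m → (a ⊛^ m) 0 ≡ 1ℤ
⊛^-at-zero-one a a₀≡1 zero    = refl
⊛^-at-zero-one a a₀≡1 (suc m) = ⊛-at-zero-one a (a ⊛^ m) a₀≡1 (⊛^-at-zero-one a a₀≡1 m)

∏-at-zero-one : ∀ F → (∀ i → F i 0 ≡ 1ℤ) → ∀ m → ∏ m F 0 ≡ 1ℤ
∏-at-zero-one F F₀≡1 zero    = refl
∏-at-zero-one F F₀≡1 (suc m) = ⊛-at-zero-one (F 0) (∏ m (F ∘ suc)) (F₀≡1 0) (∏-at-zero-one (F ∘ suc) (F₀≡1 ∘ suc) m)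

⊛-shift : ∀ c a n → c 0 ≡ 0ℤ → (c ⊛ a) (suc n) ≡ ((c ∘ suc) ⊛ a) n
⊛-shift c a n c₀≡0 = begin
  (c ⊛ a) (suc n)                     ≡⟨ ⊛-at-suc c a n ⟩
  c 0 * a (suc n) + ((c ∘ suc) ⊛ a) n ≡⟨ cong (λ x → x * a (suc n) + ((c ∘ suc) ⊛ a) n) c₀≡0 ⟩
  0ℤ + ((c ∘ suc) ⊛ a) n              ≡⟨ ℤ.+-identityˡ _ ⟩
  ((c ∘ suc) ⊛ a) n                   ∎
  where open ≡-Reasoning

SupportedAt : ℕ → PowerSeries → Set
SupportedAt r c = ∀ k → k ≢ r → c k ≡ 0ℤ

supportedAt-suc : ∀ {r c} → SupportedAt (suc r) c → SupportedAt r (c ∘ suc)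
supportedAt-suc c-supp k k≢r = c-supp (suc k) (k≢r ∘ ℕ.suc-injective)

⊛-supportedAt-below : ∀ r c a n → SupportedAt r c → n < r → (c ⊛ a) n ≡ 0ℤ
⊛-supportedAt-below (suc r) c a zero    c-supp _ =
  trans (⊛-at-zero c a) (cong (_* a 0) (c-supp 0 (λ ())))
⊛-supportedAt-below (suc r) c a (suc n) c-supp (s≤s n<r) =
  trans (⊛-shift c a n (c-supp 0 (λ ()))) (⊛-supportedAt-below r (c ∘ suc) a n (supportedAt-suc c-supp) n<r)

⊛-supportedAt : ∀ r c a n → SupportedAt r c → (c ⊛ a) (r ℕ.+ n) ≡ c r * a n
⊛-supportedAt zero c a zero c-supp = ⊛-at-zero c a
⊛-supportedAt zero c a (suc n) c-supp = begin
  (c ⊛ a) (suc n)                     ≡⟨ ⊛-at-suc c a n ⟩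
  c 0 * a (suc n) + ((c ∘ suc) ⊛ a) n ≡⟨ cong (_+_ (c 0 * a (suc n))) (⊛-cong {b = a} (λ k → c-supp (suc k) (λ ())) (λ _ → refl) n) ⟩
  c 0 * a (suc n) + ((λ _ → 0ℤ) ⊛ a) n ≡⟨ cong (_+_ (c 0 * a (suc n))) (⊛-zeroˡ a n) ⟩
  c 0 * a (suc n) + 0ℤ                ≡⟨ ℤ.+-identityʳ _ ⟩
  c 0 * a (suc n)                     ∎
  where open ≡-Reasoning
⊛-supportedAt (suc r) c a n c-supp =
  trans (⊛-shift c a (r ℕ.+ n) (c-supp 0 (λ ()))) (⊛-supportedAt r (c ∘ suc) a n (supportedAt-suc c-supp))

oneMinus-≢ : ∀ {Q n} → n ≢ 0 → n ≢ Q → oneMinus Q n ≡ 0ℤ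
oneMinus-≢ {Q} {n} n≢0 n≢Q = cong₂ (λ x y → (if x then 1ℤ else 0ℤ) + (if y then -1ℤ else 0ℤ))
  (dec-false (n ℕ.≟ 0) n≢0) (dec-false (n ℕ.≟ Q) n≢Q)

oneMinus-≡ : ∀ {Q} → Q ≢ 0 → oneMinus Q Q ≡ -1ℤ
oneMinus-≡ {Q} Q≢0 = cong₂ (λ x y → (if x then 1ℤ else 0ℤ) + (if y then -1ℤ else 0ℤ))
  (dec-false (Q ℕ.≟ 0) Q≢0) (dec-true (Q ℕ.≟ Q) refl)

oneMinus-at-zero : ∀ Q → .{{NonZero Q}} → oneMinus Q 0 ≡ 1ℤ
oneMinus-at-zero (suc q) = refl

oneMinus-tail-supportedAt : ∀ q → SupportedAt q (oneMinus (suc q) ∘ suc)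
oneMinus-tail-supportedAt q k k≢q = oneMinus-≢ (λ ()) (k≢q ∘ ℕ.suc-injective)

oneMinus-⊛-below : ∀ q a n → n < suc q → (oneMinus (suc q) ⊛ a) n ≡ a n
oneMinus-⊛-below q a zero    _ = trans (⊛-at-zero (oneMinus (suc q)) a) (ℤ.*-identityˡ (a 0))
oneMinus-⊛-below q a (suc n) (s≤s n<q) = begin
  (oneMinus (suc q) ⊛ a) (suc n)                              ≡⟨ ⊛-at-suc (oneMinus (suc q)) a n ⟩
  1ℤ * a (suc n) + ((oneMinus (suc q) ∘ suc) ⊛ a) n           ≡⟨ cong₂ _+_ (ℤ.*-identityˡ (a (suc n)))
                                                                   (⊛-supportedAt-below q _ a n (oneMinus-tail-supportedAt q) n<q) ⟩
  a (suc n) + 0ℤ                                              ≡⟨ ℤ.+-identityʳ (a (suc n)) ⟩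
  a (suc n)                                                   ∎
  where open ≡-Reasoning

oneMinus-⊛-above : ∀ q a m → (oneMinus (suc q) ⊛ a) (suc q ℕ.+ m) ≡ a (suc q ℕ.+ m) - a m
oneMinus-⊛-above q a m = begin
  (oneMinus (suc q) ⊛ a) (suc q ℕ.+ m)                               ≡⟨ ⊛-at-suc (oneMinus (suc q)) a (q ℕ.+ m) ⟩
  1ℤ * a (suc q ℕ.+ m) + ((oneMinus (suc q) ∘ suc) ⊛ a) (q ℕ.+ m)  ≡⟨ cong₂ _+_ (ℤ.*-identityˡ (a (suc q ℕ.+ m)))
                                                                        (⊛-supportedAt q _ a m (oneMinus-tail-supportedAt q)) ⟩
  a (suc q ℕ.+ m) + oneMinus (suc q) (suc q) * a m                   ≡⟨ cong (λ x → a (suc q ℕ.+ m) + x * a m) (oneMinus-≡ {suc q} (λ ())) ⟩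
  a (suc q ℕ.+ m) + -1ℤ * a m                                        ≡⟨ cong (_+_ (a (suc q ℕ.+ m))) (ℤ.-1*i≡-i (a m)) ⟩
  a (suc q ℕ.+ m) - a m                                              ∎
  where open ≡-Reasoning

geom-∣ : ∀ {Q n} → Q ℕ.∣ n → geom Q n ≡ 1ℤ
geom-∣ {Q} {n} Q∣n = cong (if_then 1ℤ else 0ℤ) (dec-true (Q ℕ.∣? n) Q∣n)

geom-∤ : ∀ {Q n} → ¬ Q ℕ.∣ n → geom Q n ≡ 0ℤ
geom-∤ {Q} {n} Q∤n = cong (if_then 1ℤ else 0ℤ) (dec-false (Q ℕ.∣? n) Q∤n)

geom-periodic : ∀ Q m → geom Q (Q ℕ.+ m) ≡ geom Q m
geom-periodic Q m with Q ℕ.∣? m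
... | yes Q∣m = geom-∣ (ℕ.∣m∣n⇒∣m+n ℕ.∣-refl Q∣m)
... | no  Q∤m = geom-∤ (λ Q∣Q+m → Q∤m (ℕ.∣m+n∣m⇒∣n Q∣Q+m ℕ.∣-refl))

oneMinus-⊛-geom : ∀ q → oneMinus (suc q) ⊛ geom (suc q) ≗ one
oneMinus-⊛-geom q n with n ℕ.<? suc q
oneMinus-⊛-geom q zero    | yes n<Q = trans (oneMinus-⊛-below q (geom (suc q)) 0 n<Q) (geom-∣ (suc q ℕ.∣0))
oneMinus-⊛-geom q (suc n) | yes n<Q = trans (oneMinus-⊛-below q (geom (suc q)) (suc n) n<Q) (geom-∤ (ℕ.<⇒≱ n<Q ∘ ℕ.∣⇒≤))
... | no n≮Q with m , refl ← ℕ.m≤n⇒∃[o]m+o≡n (ℕ.≮⇒≥ n≮Q) = begin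
  (oneMinus (suc q) ⊛ geom (suc q)) (suc q ℕ.+ m) ≡⟨ oneMinus-⊛-above q (geom (suc q)) m ⟩
  geom (suc q) (suc q ℕ.+ m) - geom (suc q) m     ≡⟨ cong (_- geom (suc q) m) (geom-periodic (suc q) m) ⟩
  geom (suc q) m - geom (suc q) m                 ≡⟨ ℤ.+-inverseʳ (geom (suc q) m) ⟩
  0ℤ                                              ∎
  where open ≡-Reasoning

geom-inverse : ∀ Q → .{{NonZero Q}} → geom Q ⊛ oneMinus Q ≗ one
geom-inverse (suc q) n = trans (⊛-comm (geom (suc q)) (oneMinus (suc q)) n) (oneMinus-⊛-geom q n)

[k+1]*[n+1]C[k+1]≡[n+1]*nCk : ∀ n k → suc k ℕ.* (suc n C suc k) ≡ suc n ℕ.* (n C k)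
[k+1]*[n+1]C[k+1]≡[n+1]*nCk zero    zero    = refl
[k+1]*[n+1]C[k+1]≡[n+1]*nCk zero    (suc k) = ℕ.*-zeroʳ (2 ℕ.+ k)
[k+1]*[n+1]C[k+1]≡[n+1]*nCk (suc n) zero    = trans (ℕ.*-identityˡ ((2 ℕ.+ n) C 1))
  (trans (nC1≡n (2 ℕ.+ n)) (sym (ℕ.*-identityʳ (2 ℕ.+ n))))
[k+1]*[n+1]C[k+1]≡[n+1]*nCk (suc n) (suc k) = begin
  (2 ℕ.+ k) ℕ.* ((2 ℕ.+ n) C (2 ℕ.+ k))
    ≡⟨ cong ((2 ℕ.+ k) ℕ.*_) (nCk+nC[k+1]≡[n+1]C[k+1] (suc n) (suc k)) ⟨
  (2 ℕ.+ k) ℕ.* (X ℕ.+ Y)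
    ≡⟨ expand k X Y ⟩
  X ℕ.+ ((1 ℕ.+ k) ℕ.* X ℕ.+ (2 ℕ.+ k) ℕ.* Y)
    ≡⟨ cong (X ℕ.+_) (cong₂ ℕ._+_ ([k+1]*[n+1]C[k+1]≡[n+1]*nCk n k) ([k+1]*[n+1]C[k+1]≡[n+1]*nCk n (suc k))) ⟩
  X ℕ.+ ((1 ℕ.+ n) ℕ.* (n C k) ℕ.+ (1 ℕ.+ n) ℕ.* (n C suc k))
    ≡⟨ cong (X ℕ.+_) (ℕ.*-distribˡ-+ (1 ℕ.+ n) (n C k) (n C suc k)) ⟨
  X ℕ.+ (1 ℕ.+ n) ℕ.* (n C k ℕ.+ n C suc k)
    ≡⟨ cong (λ Z → X ℕ.+ (1 ℕ.+ n) ℕ.* Z) (nCk+nC[k+1]≡[n+1]C[k+1] n k) ⟩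
  X ℕ.+ (1 ℕ.+ n) ℕ.* X
    ∎
  where
  open ≡-Reasoning
  X = suc n C suc k
  Y = suc n C (2 ℕ.+ k)
  expand : ∀ k X Y → (2 ℕ.+ k) ℕ.* (X ℕ.+ Y) ≡ X ℕ.+ ((1 ℕ.+ k) ℕ.* X ℕ.+ (2 ℕ.+ k) ℕ.* Y)
  expand = ℕ-solve-∀

prime∣pCk : ∀ {p k} → Prime p → 0 < k → k < p → p ℕ.∣ p C k
prime∣pCk {suc p} {suc k} p-prime _ k<p with euclidsLemma (suc k) (suc p C suc k) p-prime
  (ℕ.divides (p C k) (trans ([k+1]*[n+1]C[k+1]≡[n+1]*nCk p k) (ℕ.*-comm (suc p) (p C k))))
... | inj₁ p∣k = contradiction (ℕ.∣⇒≤ p∣k) (ℕ.<⇒≱ k<p)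
... | inj₂ p∣C = p∣C

oneMinus^-at-multiple : ∀ q m j → (oneMinus (suc q) ⊛^ m) (j ℕ.* suc q) ≡ -1ℤ ^ j * + (m C j)
oneMinus^-at-multiple q zero    zero    = refl
oneMinus^-at-multiple q zero    (suc j) = sym (ℤ.*-zeroʳ (-1ℤ ^ suc j))
oneMinus^-at-multiple q (suc m) zero    =
  trans (oneMinus-⊛-below q (oneMinus (suc q) ⊛^ m) 0 (s≤s z≤n)) (oneMinus^-at-multiple q m 0)
oneMinus^-at-multiple q (suc m) (suc j) = begin
  (oneMinus (suc q) ⊛^ suc m) (suc q ℕ.+ j ℕ.* suc q)
    ≡⟨ oneMinus-⊛-above q (oneMinus (suc q) ⊛^ m) (j ℕ.* suc q) ⟩
  (oneMinus (suc q) ⊛^ m) (suc j ℕ.* suc q) - (oneMinus (suc q) ⊛^ m) (j ℕ.* suc q)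
    ≡⟨ cong₂ _-_ (oneMinus^-at-multiple q m (suc j)) (oneMinus^-at-multiple q m j) ⟩
  -1ℤ * s * + (m C suc j) - s * + (m C j)
    ≡⟨ regroup s (+ (m C j)) (+ (m C suc j)) ⟩
  -1ℤ * s * (+ (m C j) + + (m C suc j))
    ≡⟨ cong (λ x → -1ℤ * s * x) (ℤ.pos-+ (m C j) (m C suc j)) ⟨
  -1ℤ * s * + (m C j ℕ.+ m C suc j)
    ≡⟨ cong (λ x → -1ℤ * s * + x) (nCk+nC[k+1]≡[n+1]C[k+1] m j) ⟩
  -1ℤ ^ suc j * + (suc m C suc j)
    ∎
  where
  open ≡-Reasoning
  s = -1ℤ ^ j
  regroup : ∀ s x y → -1ℤ * s * y - s * x ≡ -1ℤ * s * (x + y)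
  regroup = solve-∀

oneMinus^-off-multiple : ∀ q m j r → r < q → (oneMinus (suc q) ⊛^ m) (suc r ℕ.+ j ℕ.* suc q) ≡ 0ℤ
oneMinus^-off-multiple q zero    j       r _   = refl
oneMinus^-off-multiple q (suc m) zero    r r<q =
  trans (oneMinus-⊛-below q (oneMinus (suc q) ⊛^ m) (suc r ℕ.+ 0) (s≤s (subst (_< q) (sym (ℕ.+-identityʳ r)) r<q)))
        (oneMinus^-off-multiple q m 0 r r<q)
oneMinus^-off-multiple q (suc m) (suc j) r r<q = begin
  (oneMinus (suc q) ⊛^ suc m) (suc r ℕ.+ suc j ℕ.* suc q)
    ≡⟨ cong (oneMinus (suc q) ⊛^ suc m) (x∙yz≈y∙xz (suc r) (suc q) (j ℕ.* suc q)) ⟩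
  (oneMinus (suc q) ⊛^ suc m) (suc q ℕ.+ (suc r ℕ.+ j ℕ.* suc q))
    ≡⟨ oneMinus-⊛-above q (oneMinus (suc q) ⊛^ m) (suc r ℕ.+ j ℕ.* suc q) ⟩
  (oneMinus (suc q) ⊛^ m) (suc q ℕ.+ (suc r ℕ.+ j ℕ.* suc q)) - (oneMinus (suc q) ⊛^ m) (suc r ℕ.+ j ℕ.* suc q)
    ≡⟨ cong₂ _-_ (trans (cong (oneMinus (suc q) ⊛^ m) (x∙yz≈y∙xz (suc q) (suc r) (j ℕ.* suc q)))
                        (oneMinus^-off-multiple q m (suc j) r r<q))
                 (oneMinus^-off-multiple q m j r r<q) ⟩
  0ℤ
    ∎
  where open ≡-Reasoning

i≡0⇒m∣i : ∀ {m i} → i ≡ 0ℤ → m ∣ₛ i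
i≡0⇒m∣i refl = divides 0ℤ refl

*-cong-mod : ∀ {M} x x′ y y′ → M ∣ₛ x - x′ → M ∣ₛ y - y′ → M ∣ₛ x * y - x′ * y′
*-cong-mod {M} x x′ y y′ M∣x-x′ M∣y-y′ = subst (M ∣ₛ_) (sym (split x x′ y y′))
  (∣m∣n⇒∣m+n (∣n⇒∣m*n x M∣y-y′) (∣m⇒∣m*n y′ M∣x-x′))
  where
  split : ∀ x x′ y y′ → x * y - x′ * y′ ≡ x * (y - y′) + (x - x′) * y′
  split = solve-∀

+-cong-mod : ∀ {M} x x′ y y′ → M ∣ₛ x - x′ → M ∣ₛ y - y′ → M ∣ₛ (x + y) - (x′ + y′)
+-cong-mod {M} x x′ y y′ M∣x-x′ M∣y-y′ = subst (M ∣ₛ_) (sym (split x x′ y y′)) (∣m∣n⇒∣m+n M∣x-x′ M∣y-y′)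
  where
  split : ∀ x x′ y y′ → (x + y) - (x′ + y′) ≡ (x - x′) + (y - y′)
  split = solve-∀

infix 4 _≗_mod_
_≗_mod_ : PowerSeries → PowerSeries → ℤ → Set
a ≗ b mod M = ∀ n → M ∣ₛ a n - b n

≗-mod-refl : ∀ {M a} → a ≗ a mod M
≗-mod-refl {M} {a} n = i≡0⇒m∣i (ℤ.+-inverseʳ (a n))

≗-mod-sym : ∀ {M a b} → a ≗ b mod M → b ≗ a mod M
≗-mod-sym {M} {a} {b} a≡b n = subst (M ∣ₛ_) (negate (a n) (b n)) (∣m⇒∣-m (a≡b n))
  where
  negate : ∀ x y → - (x - y) ≡ y - x
  negate = solve-∀

≗-mod-trans : ∀ {M a b c} → a ≗ b mod M → b ≗ c mod M → a ≗ c mod M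
≗-mod-trans {M} {a} {b} {c} a≡b b≡c n =
  subst (M ∣ₛ_) (ℤ.+-minus-telescope (a n) (b n) (c n)) (∣m∣n⇒∣m+n (a≡b n) (b≡c n))

≗-mod-setoid : ℤ → Setoid 0ℓ 0ℓ
≗-mod-setoid M = record
  { Carrier = PowerSeries
  ; _≈_ = _≗_mod M
  ; isEquivalence = record
    { refl  = λ {a} → ≗-mod-refl {M} {a}
    ; sym   = λ {a} {b} → ≗-mod-sym {M} {a} {b}
    ; trans = λ {a} {b} {c} → ≗-mod-trans {M} {a} {b} {c}
    }
  }

≗⇒≗-mod : ∀ {M a b} → a ≗ b → a ≗ b mod M
≗⇒≗-mod {M} {a} {b} a≗b n = subst (λ x → M ∣ₛ a n - x) (a≗b n) (≗-mod-refl {M} {a} n)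

⊛-cong-mod : ∀ {M a a′ b b′} → a ≗ a′ mod M → b ≗ b′ mod M → a ⊛ b ≗ a′ ⊛ b′ mod M
⊛-cong-mod {M} {a} {a′} {b} {b′} a≡a′ b≡b′ zero =
  subst (M ∣ₛ_) (sym (cong₂ _-_ (⊛-at-zero a b) (⊛-at-zero a′ b′))) (*-cong-mod (a 0) (a′ 0) (b 0) (b′ 0) (a≡a′ 0) (b≡b′ 0))
⊛-cong-mod {M} {a} {a′} {b} {b′} a≡a′ b≡b′ (suc n) =
  subst (M ∣ₛ_) (sym (cong₂ _-_ (⊛-at-suc a b n) (⊛-at-suc a′ b′ n)))
    (+-cong-mod (a 0 * b (suc n)) (a′ 0 * b′ (suc n)) _ _
      (*-cong-mod (a 0) (a′ 0) (b (suc n)) (b′ (suc n)) (a≡a′ 0) (b≡b′ (suc n)))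
      (⊛-cong-mod {M} {a ∘ suc} {a′ ∘ suc} {b} {b′} (a≡a′ ∘ suc) b≡b′ n))

-1^odd≡-1 : ∀ n → n ℕ.% 2 ≡ 1 → -1ℤ ^ n ≡ -1ℤ
-1^odd≡-1 n n-odd = begin
  -1ℤ ^ n                          ≡⟨ cong (-1ℤ ^_) (ℕ.m≡m%n+[m/n]*n n 2) ⟩
  -1ℤ ^ (n ℕ.% 2 ℕ.+ h ℕ.* 2)      ≡⟨ cong (λ r → -1ℤ ^ (r ℕ.+ h ℕ.* 2)) n-odd ⟩
  -1ℤ * -1ℤ ^ (h ℕ.* 2)            ≡⟨ cong (λ e → -1ℤ * -1ℤ ^ e) (ℕ.*-comm h 2) ⟩
  -1ℤ * -1ℤ ^ (2 ℕ.* h)            ≡⟨ cong (-1ℤ *_) (ℤ.^-*-assoc -1ℤ 2 h) ⟨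
  -1ℤ * 1ℤ ^ h                     ≡⟨ cong (-1ℤ *_) (ℤ.^-zeroˡ h) ⟩
  -1ℤ                              ∎
  where
  open ≡-Reasoning
  h = n ℕ./ 2

does-*-≟ : ∀ m n Q → .{{NonZero Q}} → does (m ℕ.* Q ℕ.≟ n ℕ.* Q) ≡ does (m ℕ.≟ n)
does-*-≟ m n Q with m ℕ.≟ n
... | yes refl = trans (dec-true (m ℕ.* Q ℕ.≟ m ℕ.* Q) refl) (sym (dec-true (m ℕ.≟ m) refl))
... | no  m≢n  = trans (dec-false (m ℕ.* Q ℕ.≟ n ℕ.* Q) (m≢n ∘ ℕ.*-cancelʳ-≡ m n Q)) (sym (dec-false (m ℕ.≟ n) m≢n))

oneMinus-at-multiple : ∀ k j Q → .{{NonZero Q}} → oneMinus (k ℕ.* Q) (j ℕ.* Q) ≡ oneMinus k j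
oneMinus-at-multiple k j Q = cong₂ (λ x y → (if x then 1ℤ else 0ℤ) + (if y then -1ℤ else 0ℤ))
  (does-*-≟ j 0 Q) (does-*-≟ j k Q)

oneMinus-off-multiple : ∀ k j q r → r < q → oneMinus (k ℕ.* suc q) (suc r ℕ.+ j ℕ.* suc q) ≡ 0ℤ
oneMinus-off-multiple k j q r r<q = oneMinus-≢ {k ℕ.* suc q} {suc r ℕ.+ j ℕ.* suc q} (λ ()) λ r+jQ≡kQ → ℕ.0≢1+n (begin
  0                                  ≡⟨ ℕ.m*n%n≡0 k (suc q) ⟨
  (k ℕ.* suc q) ℕ.% suc q            ≡⟨ cong (ℕ._% suc q) r+jQ≡kQ ⟨
  (suc r ℕ.+ j ℕ.* suc q) ℕ.% suc q  ≡⟨ ℕ.[m+kn]%n≡m%n (suc r) j (suc q) ⟩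
  suc r ℕ.% suc q                    ≡⟨ ℕ.m<n⇒m%n≡m (s≤s r<q) ⟩
  suc r                              ∎)
  where open ≡-Reasoning

binomial-frobenius : ∀ {p} → Prime p → p ℕ.% 2 ≡ 1 → ∀ j → + p ∣ₛ -1ℤ ^ j * + (p C j) - oneMinus p j
binomial-frobenius {zero}  _ () _
binomial-frobenius {suc p} _ _  zero = i≡0⇒m∣i refl
binomial-frobenius {p} p-prime p-odd (suc k) with ℕ.<-cmp (suc k) p
... | tri< k<p _ _ = subst (+ p ∣ₛ_) (sym (begin
    -1ℤ ^ suc k * + (p C suc k) - oneMinus p (suc k) ≡⟨ cong (_-_ (-1ℤ ^ suc k * + (p C suc k))) (oneMinus-≢ {p} (λ ()) (ℕ.<⇒≢ k<p)) ⟩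
    -1ℤ ^ suc k * + (p C suc k) - 0ℤ                 ≡⟨ ℤ.+-identityʳ _ ⟩
    -1ℤ ^ suc k * + (p C suc k)                      ∎))
  (∣n⇒∣m*n (-1ℤ ^ suc k) (∣ᵤ⇒∣ (prime∣pCk p-prime (s≤s z≤n) k<p)))
  where open ≡-Reasoning
-- the coefficient of x^p is (-1)^p, the one place where p must be odd
... | tri≈ _ refl _ = i≡0⇒m∣i (begin
    -1ℤ ^ p * + (p C p) - oneMinus p p  ≡⟨ cong₂ (λ s x → s * + x - oneMinus p p) (-1^odd≡-1 p p-odd) (nCn≡1 p) ⟩
    -1ℤ * 1ℤ - oneMinus p p             ≡⟨ cong (_-_ -1ℤ) (oneMinus-≡ {p} (λ ())) ⟩
    0ℤ                                  ∎)
  where open ≡-Reasoning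
... | tri> _ _ k>p = i≡0⇒m∣i (begin
    -1ℤ ^ suc k * + (p C suc k) - oneMinus p (suc k)  ≡⟨ cong₂ (λ x y → -1ℤ ^ suc k * + x - y) (k>n⇒nCk≡0 k>p) (oneMinus-≢ {p} (λ ()) (ℕ.>⇒≢ k>p)) ⟩
    -1ℤ ^ suc k * 0ℤ - 0ℤ                            ≡⟨ ℤ.+-identityʳ _ ⟩
    -1ℤ ^ suc k * 0ℤ                                 ≡⟨ ℤ.*-zeroʳ (-1ℤ ^ suc k) ⟩
    0ℤ                                               ∎)
  where open ≡-Reasoning

frobenius : ∀ {p} → Prime p → p ℕ.% 2 ≡ 1 → ∀ Q → .{{NonZero Q}} → oneMinus Q ⊛^ p ≗ oneMinus (p ℕ.* Q) mod + p
frobenius {p} p-prime p-odd Q@(suc q) n =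
  subst (λ i → + p ∣ₛ (oneMinus Q ⊛^ p) i - oneMinus (p ℕ.* Q) i) (sym (ℕ.m≡m%n+[m/n]*n n Q))
    (at (n ℕ.% Q) (n ℕ./ Q) (ℕ.m%n<n n Q))
  where
  at : ∀ r j → r < Q → + p ∣ₛ (oneMinus Q ⊛^ p) (r ℕ.+ j ℕ.* Q) - oneMinus (p ℕ.* Q) (r ℕ.+ j ℕ.* Q)
  at zero j _ = subst (+ p ∣ₛ_) (sym (cong₂ _-_ (oneMinus^-at-multiple q p j) (oneMinus-at-multiple p j Q)))
    (binomial-frobenius p-prime p-odd j)
  at (suc r) j (s≤s r<q) = i≡0⇒m∣i (cong₂ _-_ (oneMinus^-off-multiple q p j r r<q) (oneMinus-off-multiple p j q r r<q))

telescope : ∀ {p} → Prime p → p ℕ.% 2 ≡ 1 → (Q : ℕ → ℕ) → (∀ i → NonZero (Q i)) → (∀ i → Q (suc i) ≡ p ℕ.* Q i) →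
            ∀ m → oneMinus (Q 0) ⊛ ∏ m (λ i → oneMinus (Q i) ⊛^ (p ℕ.∸ 1)) ≗ oneMinus (Q m) mod + p
telescope {suc p} p-prime p-odd Q Q≢0 Q-step zero = ≗⇒≗-mod (⊛-identityʳ (oneMinus (Q 0)))
telescope {suc p} p-prime p-odd Q Q≢0 Q-step (suc m) = begin
  oneMinus (Q 0) ⊛ (F 0 ⊛ ∏ m (F ∘ suc))   ≈⟨ ≗⇒≗-mod (λ n → sym (⊛-assoc (oneMinus (Q 0)) (F 0) (∏ m (F ∘ suc)) n)) ⟩
  (oneMinus (Q 0) ⊛^ suc p) ⊛ ∏ m (F ∘ suc) ≈⟨ ⊛-cong-mod {+ suc p} {oneMinus (Q 0) ⊛^ suc p} {oneMinus (suc p ℕ.* Q 0)} {∏ m (F ∘ suc)}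
                                                 (frobenius p-prime p-odd (Q 0) {{Q≢0 0}}) (≗-mod-refl {+ suc p} {∏ m (F ∘ suc)}) ⟩
  oneMinus (suc p ℕ.* Q 0) ⊛ ∏ m (F ∘ suc)  ≡⟨ cong (λ x → oneMinus x ⊛ ∏ m (F ∘ suc)) (Q-step 0) ⟨
  oneMinus (Q 1) ⊛ ∏ m (F ∘ suc)            ≈⟨ telescope p-prime p-odd (Q ∘ suc) (Q≢0 ∘ suc) (Q-step ∘ suc) m ⟩
  oneMinus (Q (suc m))                      ∎
  where
  open SetoidReasoning (≗-mod-setoid (+ suc p))
  F = λ i → oneMinus (Q i) ⊛^ p

*-pres-∣ : ∀ {M M′ x y} → M ∣ₛ x → M′ ∣ₛ y → M * M′ ∣ₛ x * y
*-pres-∣ {M} {M′} {x} {y} M∣x M′∣y = ∣-trans (*-monoˡ-∣ M′ M∣x) (*-monoʳ-∣ x M′∣y)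

⊛-divisible : ∀ {M M′} a b n → (∀ k → k ≤ n → M ∣ₛ a k) → (∀ k → k ≤ n → M′ ∣ₛ b k) → M * M′ ∣ₛ (a ⊛ b) n
⊛-divisible {M} {M′} a b zero    M∣a M′∣b =
  subst (M * M′ ∣ₛ_) (sym (⊛-at-zero a b)) (*-pres-∣ (M∣a 0 z≤n) (M′∣b 0 z≤n))
⊛-divisible {M} {M′} a b (suc n) M∣a M′∣b = subst (M * M′ ∣ₛ_) (sym (⊛-at-suc a b n))
  (∣m∣n⇒∣m+n (*-pres-∣ (M∣a 0 z≤n) (M′∣b (suc n) ℕ.≤-refl))
             (⊛-divisible (a ∘ suc) b n (λ k k≤n → M∣a (suc k) (s≤s k≤n)) (λ k k≤n → M′∣b k (ℕ.m≤n⇒m≤1+n k≤n))))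

module _ {M : ℤ} (a b : PowerSeries) (a⊛b≗1 : a ⊛ b ≗ one) (b₀≡1 : b 0 ≡ 1ℤ) where

  private
    a₀≡1 : a 0 ≡ 1ℤ
    a₀≡1 = begin
      a 0          ≡⟨ ℤ.*-identityʳ (a 0) ⟨
      a 0 * 1ℤ     ≡⟨ cong (a 0 *_) b₀≡1 ⟨
      a 0 * b 0    ≡⟨ ⊛-at-zero a b ⟨
      (a ⊛ b) 0    ≡⟨ a⊛b≗1 0 ⟩
      1ℤ           ∎
      where open ≡-Reasoning

  inverse-at-1 : a 1 + b 1 ≡ 0ℤ
  inverse-at-1 = begin
    a 1 + b 1                      ≡⟨ ℤ.+-comm (a 1) (b 1) ⟩
    b 1 + a 1                      ≡⟨ cong₂ _+_ (ℤ.*-identityˡ (b 1)) (ℤ.*-identityʳ (a 1)) ⟨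
    1ℤ * b 1 + a 1 * 1ℤ            ≡⟨ cong₂ (λ x y → x * b 1 + a 1 * y) a₀≡1 b₀≡1 ⟨
    a 0 * b 1 + a 1 * b 0          ≡⟨ cong (_+_ (a 0 * b 1)) (⊛-at-zero (a ∘ suc) b) ⟨
    a 0 * b 1 + ((a ∘ suc) ⊛ b) 0  ≡⟨ ⊛-at-suc a b 0 ⟨
    (a ⊛ b) 1                      ≡⟨ a⊛b≗1 1 ⟩
    0ℤ                             ∎
    where open ≡-Reasoning

  inverse-at-2+ : ∀ m → a (2 ℕ.+ m) + b (2 ℕ.+ m) ≡ - ((a ∘ suc) ⊛ (b ∘ suc)) m
  inverse-at-2+ m = begin
    a (2 ℕ.+ m) + b (2 ℕ.+ m)                    ≡⟨ move (a (2 ℕ.+ m)) (b (2 ℕ.+ m)) X ⟩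
    (b (2 ℕ.+ m) + (X + a (2 ℕ.+ m))) - X        ≡⟨ cong (λ u → u - X) coefficient ⟩
    0ℤ - X                                       ≡⟨ ℤ.+-identityˡ (- X) ⟩
    - X                                          ∎
    where
    open ≡-Reasoning
    X = ((a ∘ suc) ⊛ (b ∘ suc)) m
    move : ∀ x y z → x + y ≡ (y + (z + x)) - z
    move = solve-∀
    coefficient : b (2 ℕ.+ m) + (X + a (2 ℕ.+ m)) ≡ 0ℤ
    coefficient = begin
      b (2 ℕ.+ m) + (X + a (2 ℕ.+ m))                       ≡⟨ cong₂ (λ x y → x + (X + y)) (ℤ.*-identityˡ (b (2 ℕ.+ m))) (ℤ.*-identityʳ (a (2 ℕ.+ m))) ⟨
      1ℤ * b (2 ℕ.+ m) + (X + a (2 ℕ.+ m) * 1ℤ)             ≡⟨ cong₂ (λ x y → x * b (2 ℕ.+ m) + (X + a (2 ℕ.+ m) * y)) a₀≡1 b₀≡1 ⟨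
      a 0 * b (2 ℕ.+ m) + (X + a (2 ℕ.+ m) * b 0)           ≡⟨ cong (_+_ (a 0 * b (2 ℕ.+ m))) (⊛-at-sucʳ (a ∘ suc) b m) ⟨
      a 0 * b (2 ℕ.+ m) + ((a ∘ suc) ⊛ b) (suc m)           ≡⟨ ⊛-at-suc a b (suc m) ⟨
      (a ⊛ b) (2 ℕ.+ m)                                     ≡⟨ a⊛b≗1 (2 ℕ.+ m) ⟩
      0ℤ                                                    ∎

  inverse-sum-divisible : ∀ m → (∀ k → k < m → M ∣ₛ a (suc k)) → (∀ k → k < m → M ∣ₛ b (suc k)) →
                          M * M ∣ₛ a (suc m) + b (suc m)
  inverse-sum-divisible zero    _   _   = i≡0⇒m∣i inverse-at-1
  inverse-sum-divisible (suc m) M∣a M∣b = subst (M * M ∣ₛ_) (sym (inverse-at-2+ m))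
    (∣m⇒∣-m (⊛-divisible (a ∘ suc) (b ∘ suc) m (λ k k≤m → M∣a k (s≤s k≤m)) (λ k k≤m → M∣b k (s≤s k≤m))))

  inverse-divisible : ∀ m → (∀ k → k ≤ m → M ∣ₛ b (suc k)) → M ∣ₛ a (suc m) × M * M ∣ₛ a (suc m) + b (suc m)
  inverse-divisible = <-rec _ λ m rec M∣b →
    let M²∣a+b = inverse-sum-divisible m
                   (λ k k<m → proj₁ (rec k<m (λ j j≤k → M∣b j (ℕ.≤-trans j≤k (ℕ.<⇒≤ k<m)))))
                   (λ k k<m → M∣b k (ℕ.<⇒≤ k<m))
    in ∣m+n∣n⇒∣m (∣-trans (∣m⇒∣m*n M ∣ₛ-refl) M²∣a+b) (M∣b m ℕ.≤-refl) , M²∣a+b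

+[i%ℕn]≡i-[i/ℕn]*n : ∀ i n .{{_ : NonZero n}} → + (i %ℕ n) ≡ i - (i /ℕ n) * + n
+[i%ℕn]≡i-[i/ℕn]*n i n = begin
  + (i %ℕ n)                                      ≡⟨ cancel (+ (i %ℕ n)) ((i /ℕ n) * + n) ⟩
  (+ (i %ℕ n) + (i /ℕ n) * + n) - (i /ℕ n) * + n  ≡⟨ cong (_- (i /ℕ n) * + n) (a≡a%ℕn+[a/ℕn]*n i n) ⟨
  i - (i /ℕ n) * + n                              ∎
  where
  open ≡-Reasoning
  cancel : ∀ r x → r ≡ (r + x) - x
  cancel = solve-∀

[i*n]/ℕn≡i : ∀ i n .{{_ : NonZero n}} → (i * + n) /ℕ n ≡ i
[i*n]/ℕn≡i i n = sym (ℤ.*-cancelʳ-≡ i q (+ n) (begin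
  i * + n         ≡⟨ a≡a%ℕn+[a/ℕn]*n (i * + n) n ⟩
  + r + q * + n   ≡⟨ cong (λ x → + x + q * + n) r≡0 ⟩
  0ℤ + q * + n    ≡⟨ ℤ.+-identityˡ (q * + n) ⟩
  q * + n         ∎))
  where
  open ≡-Reasoning
  q = (i * + n) /ℕ n
  r = (i * + n) %ℕ n
  n∣r : n ℕ.∣ r
  n∣r = ∣⇒∣ᵤ (subst (+ n ∣ₛ_) (sym (+[i%ℕn]≡i-[i/ℕn]*n (i * + n) n))
                (∣m∣n⇒∣m-n (∣n⇒∣m*n i ∣ₛ-refl) (∣n⇒∣m*n q ∣ₛ-refl)))
  r≡0 : r ≡ 0
  r≡0 = trans (sym (ℕ.m<n⇒m%n≡m (n%ℕd<d (i * + n) n))) (ℕ.n∣m⇒m%n≡0 r n n∣r)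

[i%ℕn+j%ℕn]%n≡0 : ∀ i j n .{{_ : NonZero n}} → + n ∣ₛ i + j → (i %ℕ n ℕ.+ j %ℕ n) ℕ.% n ≡ 0
[i%ℕn+j%ℕn]%n≡0 i j n n∣i+j = ℕ.n∣m⇒m%n≡0 _ n (∣⇒∣ᵤ (subst (+ n ∣ₛ_) residues
  (∣m∣n⇒∣m-n n∣i+j (∣n⇒∣m*n (i /ℕ n + j /ℕ n) ∣ₛ-refl))))
  where
  open ≡-Reasoning
  regroup : ∀ x y u v N → (x + y) - (u + v) * N ≡ (x - u * N) + (y - v * N)
  regroup = solve-∀
  residues : (i + j) - (i /ℕ n + j /ℕ n) * + n ≡ + (i %ℕ n ℕ.+ j %ℕ n)
  residues = begin
    (i + j) - (i /ℕ n + j /ℕ n) * + n              ≡⟨ regroup i j (i /ℕ n) (j /ℕ n) (+ n) ⟩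
    (i - (i /ℕ n) * + n) + (j - (j /ℕ n) * + n)    ≡⟨ cong₂ _+_ (+[i%ℕn]≡i-[i/ℕn]*n i n) (+[i%ℕn]≡i-[i/ℕn]*n j n) ⟨
    + (i %ℕ n) + + (j %ℕ n)                        ≡⟨ ℤ.pos-+ (i %ℕ n) (j %ℕ n) ⟨
    + (i %ℕ n ℕ.+ j %ℕ n)                          ∎

quotient-residues-sum : ∀ p .{{_ : NonZero p}} x y → + p ∣ₛ x → + p ∣ₛ y → + p * + p ∣ₛ x + y →
                        ((x /ℕ p) %ℕ p ℕ.+ (y /ℕ p) %ℕ p) ℕ.% p ≡ 0
quotient-residues-sum p x y (divides s refl) (divides t refl) p²∣x+y =
  subst₂ (λ u v → (u %ℕ p ℕ.+ v %ℕ p) ℕ.% p ≡ 0) (sym ([i*n]/ℕn≡i s p)) (sym ([i*n]/ℕn≡i t p))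
    ([i%ℕn+j%ℕn]%n≡0 s t p (*-cancelʳ-∣ (+ p) (subst (+ p * + p ∣ₛ_) (sym (ℤ.*-distribʳ-+ (+ p) s t)) p²∣x+y)))

n<m^n : ∀ m n → 1 < m → n < m ℕ.^ n
n<m^n m zero    _   = s≤s z≤n
n<m^n m (suc n) 1<m = ℕ.≤-<-trans (n<m^n m n 1<m)
  (subst (m ℕ.^ n <_) (ℕ.*-comm (m ℕ.^ n) m) (ℕ.m<m*n (m ℕ.^ n) m {{ℕ.m^n≢0 m n {{ℕ.>-nonZero (ℕ.<-trans (s≤s z≤n) 1<m)}}}} 1<m))

prime⇒odd : ∀ {p} → Prime p → 3 ≤ p → p ℕ.% 2 ≡ 1
prime⇒odd {p} p-prime 3≤p with p ℕ.% 2 in eq | ℕ.m%n<n p 2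
... | 0           | _ = contradiction (composite 3≤p (ℕ.m%n≡0⇒n∣m p 2 eq)) (Prime.notComposite p-prime)
... | 1           | _ = refl
... | suc (suc _) | s≤s (s≤s ())

D₁ D₋₁ : ℕ → ℕ → PowerSeries
D₁  p N = geom 1 ⊛ prodUpTo N (λ i → geom (p ℕ.^ i) ⊛^ (p ℕ.∸ 1))
D₋₁ p N = oneMinus 1 ⊛ prodUpTo N (λ i → oneMinus (p ℕ.^ i) ⊛^ (p ℕ.∸ 1))

D₁⊛D₋₁≗one : ∀ p N → .{{NonZero p}} → D₁ p N ⊛ D₋₁ p N ≗ one
D₁⊛D₋₁≗one p N = begin
  (geom 1 ⊛ prodUpTo N G) ⊛ (oneMinus 1 ⊛ prodUpTo N H)   ≈⟨ ⊛-interchange (geom 1) (prodUpTo N G) (oneMinus 1) (prodUpTo N H) ⟩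
  (geom 1 ⊛ oneMinus 1) ⊛ (prodUpTo N G ⊛ prodUpTo N H)  ≡⟨ cong₂ (λ x y → (geom 1 ⊛ oneMinus 1) ⊛ (x ⊛ y)) (prodUpTo≡∏ N G) (prodUpTo≡∏ N H) ⟩
  (geom 1 ⊛ oneMinus 1) ⊛ (∏ (suc N) G ⊛ ∏ (suc N) H)   ≈⟨ ⊛-cong (geom-inverse 1) (∏-inverse {G} {H} G⊛H≗one (suc N)) ⟩
  one ⊛ one                                              ≈⟨ ⊛-identityˡ one ⟩
  one                                                    ∎
  where
  open SetoidReasoning ≗-setoid
  G = λ i → geom (p ℕ.^ i) ⊛^ (p ℕ.∸ 1)
  H = λ i → oneMinus (p ℕ.^ i) ⊛^ (p ℕ.∸ 1)
  G⊛H≗one : ∀ i → G i ⊛ H i ≗ one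
  G⊛H≗one i = ⊛^-inverse (geom-inverse (p ℕ.^ i) {{ℕ.m^n≢0 p i}}) (p ℕ.∸ 1)

D₋₁-at-zero : ∀ p N → .{{NonZero p}} → D₋₁ p N 0 ≡ 1ℤ
D₋₁-at-zero p N = ⊛-at-zero-one (oneMinus 1) (prodUpTo N H) refl
  (subst (λ P → P 0 ≡ 1ℤ) (sym (prodUpTo≡∏ N H))
    (∏-at-zero-one H (λ i → ⊛^-at-zero-one (oneMinus (p ℕ.^ i)) (oneMinus-at-zero (p ℕ.^ i) {{ℕ.m^n≢0 p i}}) (p ℕ.∸ 1)) (suc N)))
  where H = λ i → oneMinus (p ℕ.^ i) ⊛^ (p ℕ.∸ 1)

D₋₁≗oneMinus : ∀ {p} → Prime p → p ℕ.% 2 ≡ 1 → ∀ N → D₋₁ p N ≗ oneMinus (p ℕ.^ suc N) mod + p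
D₋₁≗oneMinus {p} p-prime p-odd N n =
  subst (λ P → + p ∣ₛ (oneMinus 1 ⊛ P) n - oneMinus (p ℕ.^ suc N) n) (sym (prodUpTo≡∏ N H))
    (telescope p-prime p-odd (p ℕ.^_) p^i≢0 (λ _ → refl) (suc N) n)
  where
  H = λ i → oneMinus (p ℕ.^ i) ⊛^ (p ℕ.∸ 1)
  p^i≢0 : ∀ i → NonZero (p ℕ.^ i)
  p^i≢0 i = ℕ.m^n≢0 p i {{ℕ.nonTrivial⇒nonZero p {{prime⇒nonTrivial p-prime}}}}

D₋₁-divisible : ∀ {p} → Prime p → p ℕ.% 2 ≡ 1 → ∀ N k → k < N → + p ∣ₛ D₋₁ p N (suc k)
D₋₁-divisible {p} p-prime p-odd N k k<N = subst (+ p ∣ₛ_)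
  (trans (cong (_-_ (D₋₁ p N (suc k))) (oneMinus-≢ (λ ()) (ℕ.<⇒≢ 1+k<p^[1+N]))) (ℤ.+-identityʳ _))
  (D₋₁≗oneMinus p-prime p-odd N (suc k))
  where
  1+k<p^[1+N] : suc k < p ℕ.^ suc N
  1+k<p^[1+N] = ℕ.<-trans (s≤s k<N) (n<m^n p (suc N) (ℕ.nonTrivial⇒n>1 p {{prime⇒nonTrivial p-prime}}))

corollary4p2 : (p : ℕ) → .{{_ : NonZero p}} → Prime p → 3 ≤ p → (n : ℕ) → 1 ≤ n →
    (+ p ∣ d₁ p n) × (+ p ∣ d₋₁ p n) ×
    ((((d₁ p n /ℕ p) %ℕ p) Data.Nat.+ ((d₋₁ p n /ℕ p) %ℕ p)) % p ≡ 0)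
corollary4p2 p p-prime 3≤p n@(suc m) _ =
  ∣⇒∣ᵤ p∣d₁ , ∣⇒∣ᵤ p∣d₋₁ , quotient-residues-sum p (d₁ p n) (d₋₁ p n) p∣d₁ p∣d₋₁ p²∣d₁+d₋₁
  where
  p∣D₋₁ : ∀ k → k ≤ m → + p ∣ₛ D₋₁ p n (suc k)
  p∣D₋₁ k k≤m = D₋₁-divisible p-prime (prime⇒odd p-prime 3≤p) n k (s≤s k≤m)
  p∣d₋₁ : + p ∣ₛ d₋₁ p n
  p∣d₋₁ = p∣D₋₁ m ℕ.≤-refl
  p∣d₁×p²∣d₁+d₋₁ : + p ∣ₛ d₁ p n × + p * + p ∣ₛ d₁ p n + d₋₁ p n
  p∣d₁×p²∣d₁+d₋₁ = inverse-divisible (D₁ p n) (D₋₁ p n) (D₁⊛D₋₁≗one p n) (D₋₁-at-zero p n) m p∣D₋₁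
  p∣d₁ = proj₁ p∣d₁×p²∣d₁+d₋₁
  p²∣d₁+d₋₁ = proj₂ p∣d₁×p²∣d₁+d₋₁
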